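{- The total number of haplotype intervals, summed over all haplotypes $S_1,\dots,S_h$, lies in $[\tilde r,\tilde r+h]$.
   Context: A haplotype panel consists of $h$ strings $S_1,\dots,S_h$, each of length $m$, over a totally ordered alphabet. The prefix array $\mathrm{PA}$ is an $h\times m$ matrix whose column $1$ is $1,\dots,h$ and whose column $j>1$ lists the haplotype indices sorted by the co-lexicographic order of the prefixes $S_1[1..j-1],\dots,S_h[1..j-1]$ (ties broken stably). The PBWT is the $h\times m$ matrix with $\mathrm{col}_j(\mathrm{PBWT})[x]=S_{\mathrm{col}_j(\mathrm{PA})[x]}[j]$. A run is a maximal block of consecutive equal symbols in a column of the PBWT, and $\tilde r$ is the total number of runs over all $m$ columns. A pair $(x,j)$ is a run-top if $x=1$ or $\mathrm{col}_j(\mathrm{PBWT})[x]\ne\mathrm{col}_j(\mathrm{PBWT})[x-1]$. Haplotype intervals of $S_i$: let $b_1<\dots<b_k=m$ be the sorted set consisting of $m$ together with all columns $j$ for which there is a row $x$ with $(x,j)$ a run-top and $\mathrm{col}_j(\mathrm{PA})[x]=i$; the haplotype intervals of $S_i$ are $[1,b_1],[b_1+1,b_2],\dots,[b_{k-1}+1,b_k]$. -}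

module Defs where

open import Level using (Level)
open import Data.Bool using (Bool; true; false; if_then_else_)
open import Data.Nat using (ℕ; zero; suc; _+_; _<ᵇ_; _≡ᵇ_)
open import Data.Fin using (Fin; toℕ)
open import Data.Fin.Properties using () renaming (_≟_ to _≟ᶠ_)
open import Data.List using (List; []; _∷_; map; reverse; filter; filterᵇ; foldr; length; derun; zip; allFin)
open import Data.Nat.ListAction using (sum)
open import Data.Bool.ListAction using (any)
open import Data.Product using (_×_; _,_)
open import Relation.Nullary using (does)
open import Relation.Binary.Definitions using (Tri; tri<; tri≈; tri>)
open import Relation.Binary.Bundles using (StrictTotalOrder)

data Cmp : Set where
  lt eq gt : Cmp

module Panel {c ℓ₁ ℓ₂ : Level} (O : StrictTotalOrder c ℓ₁ ℓ₂) where
  open StrictTotalOrder O renaming (Carrier to A)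

  lexCmp : List A → List A → Cmp
  lexCmp [] [] = eq
  lexCmp [] (_ ∷ _) = lt
  lexCmp (_ ∷ _) [] = gt
  lexCmp (x ∷ xs) (y ∷ ys) with compare x y
  ... | tri< _ _ _ = lt
  ... | tri≈ _ _ _ = lexCmp xs ys
  ... | tri> _ _ _ = gt

  colexCmp : List A → List A → Cmp
  colexCmp p q = lexCmp (reverse p) (reverse q)

  module _ {h m : ℕ} (S : Fin h → Fin m → A) where

    -- columns are 0-based here: column j (a Fin m) is column j+1 of the paper.
    -- prefix S_i[1..j-1] of the paper = first (toℕ j) symbols of S i
    prefix : Fin h → Fin m → List A
    prefix i j = map (S i) (filter (λ k → toℕ k Data.Nat.<? toℕ j) (allFin m))

    -- i strictly precedes i' in column j of PA: colex order of prefixes,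
    -- ties broken stably (by haplotype index, the order of column 1)
    before : Fin m → Fin h → Fin h → Bool
    before j i i' with colexCmp (prefix i j) (prefix i' j)
    ... | lt = true
    ... | gt = false
    ... | eq = toℕ i <ᵇ toℕ i'

    insertBy : (Fin h → Fin h → Bool) → Fin h → List (Fin h) → List (Fin h)
    insertBy r i [] = i ∷ []
    insertBy r i (k ∷ ks) = if r i k then i ∷ k ∷ ks else k ∷ insertBy r i ks

    PAcol : Fin m → List (Fin h)
    PAcol j = foldr (insertBy (before j)) [] (allFin h)

    PBWTcol : Fin m → List A
    PBWTcol j = map (λ i → S i j) (PAcol j)

    runsCol : Fin m → ℕ
    runsCol j = length (derun _≟_ (PBWTcol j))

    rTilde : ℕ
    rTilde = sum (map runsCol (allFin m))

    runTopsFrom : A → List (Fin h × A) → List (Fin h)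
    runTopsFrom a [] = []
    runTopsFrom a ((i , b) ∷ rest) =
      if does (a ≟ b) then runTopsFrom b rest else i ∷ runTopsFrom b rest

    runTops : List (Fin h × A) → List (Fin h)
    runTops [] = []
    runTops ((i , a) ∷ rest) = i ∷ runTopsFrom a rest

    runTopIdx : Fin m → List (Fin h)
    runTopIdx j = runTops (zip (PAcol j) (PBWTcol j))

    -- breakpoints b₁ < … < b_k (1-based columns): m together with the
    -- columns j where some run-top (x,j) has col_j(PA)[x] = i
    breakpoints : Fin h → List ℕ
    breakpoints i =
      map (λ j → suc (toℕ j))
        (filterᵇ (λ j → Data.Bool._∨_
                   (does (suc (toℕ j) Data.Nat.≟ m))
                   (any (λ i' → does (i ≟ᶠ i')) (runTopIdx j)))
                (allFin m))

    intervals : Fin h → List (ℕ × ℕ)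
    intervals i = zip (1 ∷ map suc (breakpoints i)) (breakpoints i)

    totalIntervals : ℕ
    totalIntervals = sum (map (λ i → length (intervals i)) (allFin h))

{-# OPTIONS --safe #-}
-- Column j is a breakpoint of S_i exactly when j is the last column or S_i
-- sits at a run-top of column j, and S_i has one interval per breakpoint.
-- Counting the pairs (i, j) column by column: a column other than the last
-- contributes one pair per run-top, i.e. its number of runs (a prefix-array
-- column is a permutation of the haplotypes, so distinct run-tops belong to
-- distinct haplotypes), while the last column contributes h, which is at
-- least its number of runs. Hence the total is r̃ − runs(m) + h.
module Submission where

open import Defs
open import Level using (Level)
open import Data.Nat using (ℕ; _≤_; _+_)
open import Data.Fin using (Fin)
open import Data.Product using (_×_)
open import Relation.Binary.Bundles using (StrictTotalOrder)

import Data.Nat.Properties as ℕ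
open import Algebra.Properties.CommutativeMonoid.Sum ℕ.+-0-commutativeMonoid
  using (sum-syntax; sum-cong-≗; sum-replicate-zero; ∑-distrib-+; ∑-comm; sum-init-last)
open import Data.Bool using (Bool; true; false; if_then_else_; _∨_)
open import Data.Bool.ListAction using (any)
open import Data.Fin using (toℕ; fromℕ; inject₁) renaming (zero to fzero; suc to fsuc)
import Data.Fin.Properties as Fin
open import Data.List using (List; []; _∷_; map; filterᵇ; foldr; length; derun; zip; allFin; tabulate)
open import Data.List.Properties using (length-map; map-tabulate; length-tabulate; length-derun)
open import Data.List.Relation.Binary.Permutation.Propositional
  using (_↭_; ↭-refl; ↭-sym; ↭-trans; prep; swap; ↭⇒↭ₛ)
open import Data.List.Relation.Binary.Permutation.Propositional.Properties using (↭-length)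
import Data.List.Relation.Binary.Permutation.Setoid.Properties as Permutationₛ
open import Data.List.Relation.Binary.Sublist.Propositional using (_⊆_; []; _∷_; _∷ʳ_)
open import Data.List.Relation.Binary.Sublist.Propositional.Properties using (All-resp-⊆)
open import Data.List.Relation.Unary.All using (All; []; _∷_)
open import Data.List.Relation.Unary.AllPairs using (AllPairs; []; _∷_)
open import Data.List.Relation.Unary.Unique.Propositional using (Unique)
open import Data.List.Relation.Unary.Unique.Propositional.Properties using (allFin⁺)
open import Data.Nat using (zero; suc; z≤n)
open import Data.Nat.ListAction using (sum)
open import Data.Product using (_,_; proj₁; proj₂)
open import Function using (_∘_; id)
open import Relation.Binary.Core using (Rel)
open import Relation.Binary.PropositionalEquality
  using (_≡_; _≢_; refl; sym; trans; cong; cong₂; subst; setoid; module ≡-Reasoning)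
open import Relation.Nullary using (does; yes; no)
open import Relation.Nullary.Decidable using (dec-true; dec-false)

private
  variable
    a b ℓ : Level
    A : Set a
    B : Set b

indicator : Bool → ℕ
indicator b = if b then 1 else 0

sum-tabulate : ∀ {n} (f : Fin n → ℕ) → sum (tabulate f) ≡ ∑[ i < n ] f i
sum-tabulate {zero}  f = refl
sum-tabulate {suc n} f = cong (f fzero +_) (sum-tabulate (f ∘ fsuc))

sum-map-allFin : ∀ {n} (f : Fin n → ℕ) → sum (map f (allFin n)) ≡ ∑[ i < n ] f i
sum-map-allFin f = trans (cong sum (map-tabulate id f)) (sum-tabulate f)

length-filterᵇ : (p : A → Bool) (xs : List A) →
                 length (filterᵇ p xs) ≡ sum (map (indicator ∘ p) xs)
length-filterᵇ p []       = refl
length-filterᵇ p (x ∷ xs) with p x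
... | true  = cong suc (length-filterᵇ p xs)
... | false = length-filterᵇ p xs

∑-one : ∀ n → ∑[ i < n ] 1 ≡ n
∑-one zero    = refl
∑-one (suc n) = cong suc (∑-one n)

∑-indicator-≡ : ∀ {n} (x : Fin n) → ∑[ i < n ] indicator (does (i Fin.≟ x)) ≡ 1
∑-indicator-≡ {suc n} fzero    = cong suc (sum-replicate-zero n)
∑-indicator-≡ {suc n} (fsuc x) = ∑-indicator-≡ x

any-≟-∉ : ∀ {n} {x : Fin n} {xs} → All (x ≢_) xs → any (λ y → does (x Fin.≟ y)) xs ≡ false
any-≟-∉ []                   = refl
any-≟-∉ {x = x} (x≢y ∷ x∉xs) = cong₂ _∨_ (dec-false (x Fin.≟ _) x≢y) (any-≟-∉ x∉xs)

∑-indicator-∈ : ∀ {n} {xs : List (Fin n)} → Unique xs →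
                ∑[ i < n ] indicator (any (λ x → does (i Fin.≟ x)) xs) ≡ length xs
∑-indicator-∈ {n} [] = sum-replicate-zero n
∑-indicator-∈ {n} {x ∷ xs} (x∉xs ∷ xs!) = begin
    ∑[ i < n ] indicator (does (i Fin.≟ x) ∨ member i)
  ≡⟨ sum-cong-≗ split ⟩
    ∑[ i < n ] (indicator (does (i Fin.≟ x)) + indicator (member i))
  ≡⟨ ∑-distrib-+ (indicator ∘ does ∘ (Fin._≟ x)) (indicator ∘ member) ⟩
    ∑[ i < n ] indicator (does (i Fin.≟ x)) + ∑[ i < n ] indicator (member i)
  ≡⟨ cong₂ _+_ (∑-indicator-≡ x) (∑-indicator-∈ xs!) ⟩
    suc (length xs)
  ∎
  where
  open ≡-Reasoning
  member : Fin n → Bool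
  member i = any (λ y → does (i Fin.≟ y)) xs
  split : ∀ i → indicator (does (i Fin.≟ x) ∨ member i)
              ≡ indicator (does (i Fin.≟ x)) + indicator (member i)
  split i with i Fin.≟ x
  ... | no _     = refl
  ... | yes refl = cong (suc ∘ indicator) (sym (any-≟-∉ x∉xs))

AllPairs-resp-⊆ : {R : Rel A ℓ} {xs ys : List A} → xs ⊆ ys → AllPairs R ys → AllPairs R xs
AllPairs-resp-⊆ []         []         = []
AllPairs-resp-⊆ (_ ∷ʳ τ)   (_ ∷ pys)  = AllPairs-resp-⊆ τ pys
AllPairs-resp-⊆ (refl ∷ τ) (px ∷ pys) = All-resp-⊆ τ px ∷ AllPairs-resp-⊆ τ pys

map-proj₁-zip-map : (f : A → B) (xs : List A) → map proj₁ (zip xs (map f xs)) ≡ xs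
map-proj₁-zip-map f []       = refl
map-proj₁-zip-map f (x ∷ xs) = cong (x ∷_) (map-proj₁-zip-map f xs)

map-proj₂-zip-map : (f : A → B) (xs : List A) → map proj₂ (zip xs (map f xs)) ≡ map f xs
map-proj₂-zip-map f []       = refl
map-proj₂-zip-map f (x ∷ xs) = cong (f x ∷_) (map-proj₂-zip-map f xs)

length-zip-∷-map : (y : B) (f : A → B) (xs : List A) → length (zip (y ∷ map f xs) xs) ≡ length xs
length-zip-∷-map y f []       = refl
length-zip-∷-map y f (x ∷ xs) = cong suc (length-zip-∷-map (f x) f xs)

isLast : ∀ {m} → Fin m → Bool
isLast {m} j = does (suc (toℕ j) ℕ.≟ m)

isLast-fromℕ : ∀ n → isLast (fromℕ n) ≡ true
isLast-fromℕ n = dec-true (suc (toℕ (fromℕ n)) ℕ.≟ suc n) (cong suc (Fin.toℕ-fromℕ n))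

isLast-inject₁ : ∀ {n} (j : Fin n) → isLast (inject₁ j) ≡ false
isLast-inject₁ {n} j = dec-false (suc (toℕ (inject₁ j)) ℕ.≟ suc n) not-last
  where
  not-last : suc (toℕ (inject₁ j)) ≢ suc n
  not-last e = ℕ.<⇒≢ (Fin.toℕ<n j) (trans (sym (Fin.toℕ-inject₁ j)) (ℕ.suc-injective e))

∑-if-isLast : ∀ {n} x (f : Fin (suc n) → ℕ) →
  ∑[ j < suc n ] (if isLast j then x else f j) ≡ ∑[ j < n ] f (inject₁ j) + x
∑-if-isLast {n} x f = trans (sum-init-last (λ j → if isLast j then x else f j))
  (cong₂ _+_ (sum-cong-≗ (λ j → cong (if_then x else f (inject₁ j)) (isLast-inject₁ j)))
             (cong (if_then x else f (fromℕ n)) (isLast-fromℕ n)))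

∑-if-isLast-bounds : ∀ {m h} (r : Fin m → ℕ) → (∀ j → r j ≤ h) →
  let t = ∑[ j < m ] (if isLast j then h else r j) in
  (∑[ j < m ] r j ≤ t) × (t ≤ ∑[ j < m ] r j + h)
∑-if-isLast-bounds {zero}      r r≤h = z≤n , z≤n
∑-if-isLast-bounds {suc n} {h} r r≤h
  rewrite ∑-if-isLast h r | sum-init-last r
  = ℕ.+-monoʳ-≤ (∑[ j < n ] r (inject₁ j)) (r≤h (fromℕ n))
  , ℕ.+-monoˡ-≤ h (ℕ.m≤m+n _ _)

module _ {c ℓ₁ ℓ₂ : Level} (O : StrictTotalOrder c ℓ₁ ℓ₂) {h m : ℕ}
         (S : Fin h → Fin m → StrictTotalOrder.Carrier O) where
  open StrictTotalOrder O using (_≟_)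
  open Panel O

  insertBy-↭ : ∀ r i ks → insertBy S r i ks ↭ i ∷ ks
  insertBy-↭ r i []       = ↭-refl
  insertBy-↭ r i (k ∷ ks) with r i k
  ... | true  = ↭-refl
  ... | false = ↭-trans (prep k (insertBy-↭ r i ks)) (swap k i ↭-refl)

  insertionSort-↭ : ∀ r is → foldr (insertBy S r) [] is ↭ is
  insertionSort-↭ r []       = ↭-refl
  insertionSort-↭ r (i ∷ is) = ↭-trans (insertBy-↭ r i _) (prep i (insertionSort-↭ r is))

  PAcol-↭ : ∀ j → PAcol S j ↭ allFin h
  PAcol-↭ j = insertionSort-↭ (before S j) (allFin h)

  PAcol-unique : ∀ j → Unique (PAcol S j)
  PAcol-unique j =
    Permutationₛ.Unique-resp-↭ (setoid (Fin h)) (↭⇒↭ₛ (↭-sym (PAcol-↭ j))) (allFin⁺ h)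

  length-PAcol : ∀ j → length (PAcol S j) ≡ h
  length-PAcol j = trans (↭-length (PAcol-↭ j)) (length-tabulate id)

  runsCol≤h : ∀ j → runsCol S j ≤ h
  runsCol≤h j = ℕ.≤-trans (length-derun _≟_ (PBWTcol S j))
    (ℕ.≤-reflexive (trans (length-map _ (PAcol S j)) (length-PAcol j)))

  runTopsFrom-⊆ : ∀ x ps → runTopsFrom S x ps ⊆ map proj₁ ps
  runTopsFrom-⊆ x []             = []
  runTopsFrom-⊆ x ((i , y) ∷ ps) with does (x ≟ y)
  ... | true  = i ∷ʳ runTopsFrom-⊆ y ps
  ... | false = refl ∷ runTopsFrom-⊆ y ps

  runTops-⊆ : ∀ ps → runTops S ps ⊆ map proj₁ ps
  runTops-⊆ []             = []
  runTops-⊆ ((i , x) ∷ ps) = refl ∷ runTopsFrom-⊆ x ps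

  length-runTopsFrom : ∀ x ps →
    suc (length (runTopsFrom S x ps)) ≡ length (derun _≟_ (x ∷ map proj₂ ps))
  length-runTopsFrom x []             = refl
  length-runTopsFrom x ((i , y) ∷ ps) with does (x ≟ y)
  ... | true  = length-runTopsFrom y ps
  ... | false = cong suc (length-runTopsFrom y ps)

  length-runTops : ∀ ps → length (runTops S ps) ≡ length (derun _≟_ (map proj₂ ps))
  length-runTops []             = refl
  length-runTops ((i , x) ∷ ps) = length-runTopsFrom x ps

  runTopIdx-unique : ∀ j → Unique (runTopIdx S j)
  runTopIdx-unique j = AllPairs-resp-⊆ (runTops-⊆ (zip (PAcol S j) (PBWTcol S j)))
    (subst Unique (sym (map-proj₁-zip-map (λ i → S i j) (PAcol S j))) (PAcol-unique j))

  length-runTopIdx : ∀ j → length (runTopIdx S j) ≡ runsCol S j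
  length-runTopIdx j = trans (length-runTops (zip (PAcol S j) (PBWTcol S j)))
    (cong (length ∘ derun _≟_) (map-proj₂-zip-map (λ i → S i j) (PAcol S j)))

  isBreakpoint : Fin h → Fin m → Bool
  isBreakpoint i j = isLast j ∨ any (λ i' → does (i Fin.≟ i')) (runTopIdx S j)

  length-intervals : ∀ i → length (intervals S i) ≡ ∑[ j < m ] indicator (isBreakpoint i j)
  length-intervals i = begin
      length (intervals S i)
    ≡⟨ length-zip-∷-map 1 suc (breakpoints S i) ⟩
      length (breakpoints S i)
    ≡⟨ length-map (suc ∘ toℕ) (filterᵇ (isBreakpoint i) (allFin m)) ⟩
      length (filterᵇ (isBreakpoint i) (allFin m))
    ≡⟨ length-filterᵇ (isBreakpoint i) (allFin m) ⟩
      sum (map (indicator ∘ isBreakpoint i) (allFin m))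
    ≡⟨ sum-map-allFin (indicator ∘ isBreakpoint i) ⟩
      ∑[ j < m ] indicator (isBreakpoint i j)
    ∎
    where open ≡-Reasoning

  ∑-isBreakpoint : ∀ j →
    ∑[ i < h ] indicator (isBreakpoint i j) ≡ (if isLast j then h else runsCol S j)
  ∑-isBreakpoint j with isLast j
  ... | true  = ∑-one h
  ... | false = trans (∑-indicator-∈ (runTopIdx-unique j)) (length-runTopIdx j)

  totalIntervals≡ : totalIntervals S ≡ ∑[ j < m ] (if isLast j then h else runsCol S j)
  totalIntervals≡ = begin
      totalIntervals S
    ≡⟨ sum-map-allFin (length ∘ intervals S) ⟩
      ∑[ i < h ] length (intervals S i)
    ≡⟨ sum-cong-≗ length-intervals ⟩
      ∑[ i < h ] ∑[ j < m ] indicator (isBreakpoint i j)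
    ≡⟨ ∑-comm (λ i j → indicator (isBreakpoint i j)) ⟩
      ∑[ j < m ] ∑[ i < h ] indicator (isBreakpoint i j)
    ≡⟨ sum-cong-≗ ∑-isBreakpoint ⟩
      ∑[ j < m ] (if isLast j then h else runsCol S j)
    ∎
    where open ≡-Reasoning

  rTilde≡ : rTilde S ≡ ∑[ j < m ] runsCol S j
  rTilde≡ = sum-map-allFin (runsCol S)

proposition4 : ∀ {c ℓ₁ ℓ₂ : Level} (O : StrictTotalOrder c ℓ₁ ℓ₂) (h m : ℕ)
    (S : Fin h → Fin m → StrictTotalOrder.Carrier O) →
    (Panel.rTilde O S ≤ Panel.totalIntervals O S)
    × (Panel.totalIntervals O S ≤ Panel.rTilde O S + h)
proposition4 O h m S rewrite rTilde≡ O S | totalIntervals≡ O S =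
  ∑-if-isLast-bounds (Panel.runsCol O S) (runsCol≤h O S)
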